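{- Let $n$ be a non-negative integer. For every integer $r\ge1$, \[ \sum_{k=0}^n\binom{n}{k}\frac{(-1)^k}{(k+1)(k+2)(k+r)} = \frac{1}{(n+1)(n+2)\cdots(n+r)}\sum_{k=0}^n\frac{\prod_{j=1}^{r-1}(k+j)}{k+2}, \] where the empty product (for $r=1$) equals $1$. In particular, \[ \sum_{k=0}^n\binom{n}{k}\frac{(-1)^k}{(k+1)^2(k+2)} = \frac{H_{n+2}-1}{n+1},\qquad \sum_{k=0}^n\binom{n}{k}\frac{(-1)^k}{(k+1)(k+2)^2} = \frac{n+2-H_{n+2}}{(n+1)(n+2)}, \] and \[ \sum_{k=0}^n\binom{n}{k}\frac{(-1)^k}{(k+1)(k+2)(k+3)} = \frac{1}{2(n+3)}. \]
   Context: For integers $m\ge0$, $H_m=\sum_{j=1}^m1/j$. -}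

module Defs where

open import Data.Nat as ℕ using (ℕ; zero; suc)
open import Data.Nat.Combinatorics using (_C_)
open import Data.Integer as ℤ using (ℤ; +_)
open import Data.Rational as ℚ using (ℚ; _/_; _+_; _*_; _-_; -_)

-- Σ[k=0..n] f k  (inclusive upper bound)
sumTo : ℕ → (ℕ → ℚ) → ℚ
sumTo zero    f = f zero
sumTo (suc n) f = sumTo n f + f (suc n)

nat : ℕ → ℚ
nat m = + m / 1

sign : ℕ → ℚ
sign zero    = nat 1
sign (suc k) = - sign k

risingFrom : ℕ → ℕ → ℕ
risingFrom k zero    = 1
risingFrom k (suc m) = risingFrom k m ℕ.* (k ℕ.+ suc m)

H : ℕ → ℚ
H zero    = nat 0
H (suc m) = H m + (+ 1 / suc m)

-- a / d for d ≥ 1 (the statement only ever uses it with positive d;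
-- the value at d = 0 is the arbitrary convention 0)
frac : ℤ → ℕ → ℚ
frac a zero    = nat 0
frac a (suc d) = a / suc d

{-# OPTIONS --safe #-}
-- Write A n g = Σₖ C(n,k) (-1)ᵏ g k.  The absorption identity C(n+1,k) (n+1-k) = (n+1) C(n,k) gives,
-- whenever (k+c) g k = h k for all k,
--   (n+1+c) A (n+1) g = (n+1) A n g + A (n+1) h.
-- Taking h = 1, then h = 1/(k+1), yields A n (1/(k+1)) = 1/(n+1) and A n (1/((k+1)(k+2))) = 1/(n+2).
-- Taking h = 1/((k+1)(k+2)) and multiplying by P = (n+2)⋯(n+r) then shows that
-- R n = (n+1)⋯(n+r) times A n (1/((k+1)(k+2)(k+r))) grows by exactly P/(n+3) from n to n+1,
-- which sums to the general identity.  For r = 1, 2, 3 the inner sum is a harmonic sum,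
-- (n+2) minus a harmonic sum, and half a product of consecutive integers.
module Submission where

open import Defs
open import Data.Nat as ℕ using (ℕ; zero; suc)
open import Data.Nat.Combinatorics using (_C_; nC1≡n; nCk+nC[k+1]≡[n+1]C[k+1]; k>n⇒nCk≡0)
open import Data.Integer as ℤ using (+_)
open import Data.Rational as ℚ using (ℚ; _+_; _*_; _-_; -_; _/_; toℚᵘ; 0ℚ; 1ℚ)
open import Data.Product using (_×_; _,_)
open import Data.Sum using ([_,_]′)
open import Relation.Binary.PropositionalEquality
open import Relation.Nullary using (contradiction)
open import Algebra.Bundles using (CommutativeMonoid)
import Algebra.Properties.CommutativeSemigroup as CommutativeSemigroupProperties
import Data.Integer.Properties as ℤP
import Data.Nat.Properties as ℕP
import Data.Rational.Properties as ℚP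
import Data.Rational.Unnormalised as ℚᵘ
import Data.Rational.Unnormalised.Properties as ℚᵘP
open import Data.Rational.Solver using (module +-*-Solver)

open +-*-Solver
open ≡-Reasoning
module ℕ* = CommutativeSemigroupProperties ℕP.*-commutativeSemigroup
module ℚ+ = CommutativeSemigroupProperties (CommutativeMonoid.commutativeSemigroup ℚP.+-0-commutativeMonoid)
module ℚ* = CommutativeSemigroupProperties (CommutativeMonoid.commutativeSemigroup ℚP.*-1-commutativeMonoid)

toℚᵘ-/ : ∀ i d → toℚᵘ (i / suc d) ℚᵘ.≃ ℚᵘ.mkℚᵘ i d
toℚᵘ-/ i d = ℚP.toℚᵘ-fromℚᵘ (ℚᵘ.mkℚᵘ i d)

nat-+ : ∀ a b → nat (a ℕ.+ b) ≡ nat a + nat b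
nat-+ a b = ℚP.toℚᵘ-injective (begin-≃
  toℚᵘ (nat (a ℕ.+ b))                  ≈⟨ toℚᵘ-/ (+ (a ℕ.+ b)) 0 ⟩
  ℚᵘ.mkℚᵘ (+ (a ℕ.+ b)) 0               ≈⟨ ℚᵘ.*≡* cross ⟩
  ℚᵘ.mkℚᵘ (+ a) 0 ℚᵘ.+ ℚᵘ.mkℚᵘ (+ b) 0  ≈⟨ ℚᵘP.+-cong (toℚᵘ-/ (+ a) 0) (toℚᵘ-/ (+ b) 0) ⟨
  toℚᵘ (nat a) ℚᵘ.+ toℚᵘ (nat b)        ≈⟨ ℚP.toℚᵘ-homo-+ (nat a) (nat b) ⟨
  toℚᵘ (nat a + nat b)                  ∎-≃)
  where
  open ℚᵘP.≃-Reasoning renaming (begin_ to begin-≃_; _∎ to _∎-≃)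
  cross : + (a ℕ.+ b) ℤ.* + 1 ≡ (+ a ℤ.* + 1 ℤ.+ + b ℤ.* + 1) ℤ.* + 1
  cross rewrite ℤP.*-identityʳ (+ (a ℕ.+ b)) | ℤP.*-identityʳ (+ a) | ℤP.*-identityʳ (+ b)
              | ℤP.*-identityʳ (+ a ℤ.+ + b) = ℤP.pos-+ a b

nat-* : ∀ a b → nat (a ℕ.* b) ≡ nat a * nat b
nat-* a b = ℚP.toℚᵘ-injective (begin-≃
  toℚᵘ (nat (a ℕ.* b))                  ≈⟨ toℚᵘ-/ (+ (a ℕ.* b)) 0 ⟩
  ℚᵘ.mkℚᵘ (+ (a ℕ.* b)) 0               ≈⟨ ℚᵘ.*≡* cross ⟩
  ℚᵘ.mkℚᵘ (+ a) 0 ℚᵘ.* ℚᵘ.mkℚᵘ (+ b) 0  ≈⟨ ℚᵘP.*-cong (toℚᵘ-/ (+ a) 0) (toℚᵘ-/ (+ b) 0) ⟨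
  toℚᵘ (nat a) ℚᵘ.* toℚᵘ (nat b)        ≈⟨ ℚP.toℚᵘ-homo-* (nat a) (nat b) ⟨
  toℚᵘ (nat a * nat b)                  ∎-≃)
  where
  open ℚᵘP.≃-Reasoning renaming (begin_ to begin-≃_; _∎ to _∎-≃)
  cross : + (a ℕ.* b) ℤ.* + 1 ≡ (+ a ℤ.* + b) ℤ.* + 1
  cross rewrite ℤP.*-identityʳ (+ (a ℕ.* b)) | ℤP.*-identityʳ (+ a ℤ.* + b) = ℤP.pos-* a b

frac-inverse : ∀ m {D} → D ≢ 0 → nat D * frac (+ m) D ≡ nat m
frac-inverse m {zero}  D≢0 = contradiction refl D≢0
frac-inverse m {suc d} _   = ℚP.toℚᵘ-injective (begin-≃
  toℚᵘ (nat (suc d) * frac (+ m) (suc d))           ≈⟨ ℚP.toℚᵘ-homo-* (nat (suc d)) (frac (+ m) (suc d)) ⟩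
  toℚᵘ (nat (suc d)) ℚᵘ.* toℚᵘ (frac (+ m) (suc d)) ≈⟨ ℚᵘP.*-cong (toℚᵘ-/ (+ suc d) 0) (toℚᵘ-/ (+ m) d) ⟩
  ℚᵘ.mkℚᵘ (+ suc d) 0 ℚᵘ.* ℚᵘ.mkℚᵘ (+ m) d          ≈⟨ ℚᵘ.*≡* cross ⟩
  ℚᵘ.mkℚᵘ (+ m) 0                                   ≈⟨ toℚᵘ-/ (+ m) 0 ⟨
  toℚᵘ (nat m)                                      ∎-≃)
  where
  open ℚᵘP.≃-Reasoning renaming (begin_ to begin-≃_; _∎ to _∎-≃)
  cross : (+ suc d ℤ.* + m) ℤ.* + 1 ≡ + m ℤ.* + (1 ℕ.* suc d)
  cross rewrite ℤP.*-identityʳ (+ suc d ℤ.* + m) | ℕP.*-identityˡ (suc d) = ℤP.*-comm (+ suc d) (+ m)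

nat*≡⇒≡frac1* : ∀ {D x y} → D ≢ 0 → nat D * x ≡ y → x ≡ frac (+ 1) D * y
nat*≡⇒≡frac1* {D} {x} {y} D≢0 Dx≡y = begin
  x
    ≡⟨ ℚP.*-identityˡ x ⟨
  1ℚ * x
    ≡⟨ cong (_* x) (trans (ℚP.*-comm (frac (+ 1) D) (nat D)) (frac-inverse 1 D≢0)) ⟨
  frac (+ 1) D * nat D * x
    ≡⟨ ℚP.*-assoc (frac (+ 1) D) (nat D) x ⟩
  frac (+ 1) D * (nat D * x)
    ≡⟨ cong (frac (+ 1) D *_) Dx≡y ⟩
  frac (+ 1) D * y ∎

frac-unique : ∀ m {D x} → D ≢ 0 → nat D * x ≡ nat m → x ≡ frac (+ m) D
frac-unique m D≢0 Dx≡m =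
  trans (nat*≡⇒≡frac1* D≢0 Dx≡m) (sym (nat*≡⇒≡frac1* D≢0 (frac-inverse m D≢0)))

*-≢0 : ∀ {a b} → a ≢ 0 → b ≢ 0 → a ℕ.* b ≢ 0
*-≢0 {a} a≢0 b≢0 ab≡0 = [ a≢0 , b≢0 ]′ (ℕP.m*n≡0⇒m≡0∨n≡0 a ab≡0)

risingFrom≢0 : ∀ k m → risingFrom k m ≢ 0
risingFrom≢0 k zero    = λ ()
risingFrom≢0 k (suc m) = *-≢0 (risingFrom≢0 k m) (ℕP.m+1+n≢0 k)

nat*frac1≡frac : ∀ p {D} → D ≢ 0 → nat p * frac (+ 1) D ≡ frac (+ p) D
nat*frac1≡frac p {D} D≢0 = frac-unique p D≢0 (begin
  nat D * (nat p * frac (+ 1) D)  ≡⟨ ℚ*.x∙yz≈y∙xz (nat D) (nat p) _ ⟩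
  nat p * (nat D * frac (+ 1) D)  ≡⟨ cong (nat p *_) (frac-inverse 1 D≢0) ⟩
  nat p * 1ℚ                      ≡⟨ ℚP.*-identityʳ (nat p) ⟩
  nat p                           ∎)

nat*frac[a*b]≡frac : ∀ {a b} → a ≢ 0 → b ≢ 0 → nat b * frac (+ 1) (a ℕ.* b) ≡ frac (+ 1) a
nat*frac[a*b]≡frac {a} {b} a≢0 b≢0 = frac-unique 1 a≢0 (begin
  nat a * (nat b * frac (+ 1) (a ℕ.* b))  ≡⟨ ℚP.*-assoc (nat a) (nat b) _ ⟨
  nat a * nat b * frac (+ 1) (a ℕ.* b)    ≡⟨ cong (_* frac (+ 1) (a ℕ.* b)) (nat-* a b) ⟨
  nat (a ℕ.* b) * frac (+ 1) (a ℕ.* b)    ≡⟨ frac-inverse 1 (*-≢0 a≢0 b≢0) ⟩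
  nat 1                                   ∎)

frac[a*b/b]≡a : ∀ a {b} → b ≢ 0 → frac (+ (a ℕ.* b)) b ≡ nat a
frac[a*b/b]≡a a {b} b≢0 = sym (frac-unique (a ℕ.* b) b≢0 (trans (ℚP.*-comm (nat b) (nat a)) (sym (nat-* a b))))

sumTo-cong : ∀ n {f g : ℕ → ℚ} → (∀ k → f k ≡ g k) → sumTo n f ≡ sumTo n g
sumTo-cong zero    f≗g = f≗g 0
sumTo-cong (suc n) f≗g = cong₂ _+_ (sumTo-cong n f≗g) (f≗g (suc n))

sumTo-+ : ∀ n (f g : ℕ → ℚ) → sumTo n (λ k → f k + g k) ≡ sumTo n f + sumTo n g
sumTo-+ zero    f g = refl
sumTo-+ (suc n) f g = begin
  sumTo n (λ k → f k + g k) + (f (suc n) + g (suc n))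
    ≡⟨ cong (_+ (f (suc n) + g (suc n))) (sumTo-+ n f g) ⟩
  sumTo n f + sumTo n g + (f (suc n) + g (suc n))
    ≡⟨ ℚ+.interchange (sumTo n f) (sumTo n g) (f (suc n)) (g (suc n)) ⟩
  sumTo n f + f (suc n) + (sumTo n g + g (suc n)) ∎

sumTo-*ˡ : ∀ n c (f : ℕ → ℚ) → sumTo n (λ k → c * f k) ≡ c * sumTo n f
sumTo-*ˡ zero    c f = refl
sumTo-*ˡ (suc n) c f = begin
  sumTo n (λ k → c * f k) + c * f (suc n)  ≡⟨ cong (_+ c * f (suc n)) (sumTo-*ˡ n c f) ⟩
  c * sumTo n f + c * f (suc n)            ≡⟨ ℚP.*-distribˡ-+ c (sumTo n f) (f (suc n)) ⟨
  c * (sumTo n f + f (suc n))              ∎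

sumTo-telescope : ∀ n (a : ℕ → ℚ) → sumTo n (λ k → a (suc k) - a k) ≡ a (suc n) - a 0
sumTo-telescope zero    a = refl
sumTo-telescope (suc n) a = begin
  sumTo n (λ k → a (suc k) - a k) + (a (suc (suc n)) - a (suc n))
    ≡⟨ cong (_+ (a (suc (suc n)) - a (suc n))) (sumTo-telescope n a) ⟩
  a (suc n) - a 0 + (a (suc (suc n)) - a (suc n))
    ≡⟨ solve 3 (λ x y z → (y :- x) :+ (z :- y) := z :- x) refl (a 0) (a (suc n)) (a (suc (suc n))) ⟩
  a (suc (suc n)) - a 0 ∎

[k+1]*[n+1]C[k+1]≡[n+1]*nCk : ∀ n k → suc k ℕ.* (suc n C suc k) ≡ suc n ℕ.* (n C k)
[k+1]*[n+1]C[k+1]≡[n+1]*nCk zero    zero    = refl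
[k+1]*[n+1]C[k+1]≡[n+1]*nCk zero    (suc k) = ℕP.*-zeroʳ (2 ℕ.+ k)
[k+1]*[n+1]C[k+1]≡[n+1]*nCk (suc n) zero    =
  trans (ℕP.*-identityˡ _) (trans (nC1≡n (2 ℕ.+ n)) (sym (ℕP.*-identityʳ (2 ℕ.+ n))))
[k+1]*[n+1]C[k+1]≡[n+1]*nCk (suc n) (suc k) = begin
  suc (suc k) ℕ.* (suc (suc n) C suc (suc k))
    ≡⟨ cong (suc (suc k) ℕ.*_) (nCk+nC[k+1]≡[n+1]C[k+1] (suc n) (suc k)) ⟨
  suc (suc k) ℕ.* (A ℕ.+ suc n C suc (suc k))
    ≡⟨ ℕP.*-distribˡ-+ (suc (suc k)) A _ ⟩
  A ℕ.+ suc k ℕ.* A ℕ.+ suc (suc k) ℕ.* (suc n C suc (suc k))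
    ≡⟨ cong₂ (λ x y → A ℕ.+ x ℕ.+ y) ([k+1]*[n+1]C[k+1]≡[n+1]*nCk n k) ([k+1]*[n+1]C[k+1]≡[n+1]*nCk n (suc k)) ⟩
  A ℕ.+ suc n ℕ.* (n C k) ℕ.+ suc n ℕ.* (n C suc k)
    ≡⟨ ℕP.+-assoc A _ _ ⟩
  A ℕ.+ (suc n ℕ.* (n C k) ℕ.+ suc n ℕ.* (n C suc k))
    ≡⟨ cong (A ℕ.+_) (ℕP.*-distribˡ-+ (suc n) (n C k) (n C suc k)) ⟨
  A ℕ.+ suc n ℕ.* (n C k ℕ.+ n C suc k)
    ≡⟨ cong (λ x → A ℕ.+ suc n ℕ.* x) (nCk+nC[k+1]≡[n+1]C[k+1] n k) ⟩
  A ℕ.+ suc n ℕ.* A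
    ∎
  where A = suc n C suc k

[n+1]Ck*[n+1-k]≡[n+1]*nCk : ∀ n k → nat (suc n C k) * (nat (suc n) - nat k) ≡ nat (suc n) * nat (n C k)
[n+1]Ck*[n+1-k]≡[n+1]*nCk n zero =
  solve 1 (λ N → con 1ℚ :* (N :- con 0ℚ) := N :* con 1ℚ) refl (nat (suc n))
[n+1]Ck*[n+1-k]≡[n+1]*nCk n (suc k) = begin
  X * (N - K)          ≡⟨ solve 3 (λ X N K → X :* (N :- K) := X :* N :- K :* X) refl X N K ⟩
  X * N - K * X        ≡⟨ cong₂ (λ u v → u * N - v) pascal absorption ⟩
  (Y + Z) * N - N * Y  ≡⟨ solve 3 (λ Y Z N → (Y :+ Z) :* N :- N :* Y := N :* Z) refl Y Z N ⟩
  N * Z                ∎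
  where
  N = nat (suc n)
  K = nat (suc k)
  X = nat (suc n C suc k)
  Y = nat (n C k)
  Z = nat (n C suc k)
  pascal : X ≡ Y + Z
  pascal = trans (cong nat (sym (nCk+nC[k+1]≡[n+1]C[k+1] n k))) (nat-+ (n C k) (n C suc k))
  absorption : K * X ≡ N * Y
  absorption = begin
    K * X                            ≡⟨ nat-* (suc k) (suc n C suc k) ⟨
    nat (suc k ℕ.* (suc n C suc k))  ≡⟨ cong nat ([k+1]*[n+1]C[k+1]≡[n+1]*nCk n k) ⟩
    nat (suc n ℕ.* (n C k))          ≡⟨ nat-* (suc n) (n C k) ⟩
    N * Y                            ∎

alternatingSum : ℕ → (ℕ → ℚ) → ℚ
alternatingSum n g = sumTo n (λ k → nat (n C k) * sign k * g k)

alternatingSum-zero : ∀ g → alternatingSum 0 g ≡ g 0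
alternatingSum-zero g = ℚP.*-identityˡ (g 0)

alternatingSum-cong : ∀ n {f g : ℕ → ℚ} → (∀ k → f k ≡ g k) → alternatingSum n f ≡ alternatingSum n g
alternatingSum-cong n f≗g = sumTo-cong n (λ k → cong (nat (n C k) * sign k *_) (f≗g k))

alternatingSum-+ : ∀ n (f g : ℕ → ℚ) →
                   alternatingSum n (λ k → f k + g k) ≡ alternatingSum n f + alternatingSum n g
alternatingSum-+ n f g =
  trans (sumTo-cong n (λ k → ℚP.*-distribˡ-+ (nat (n C k) * sign k) (f k) (g k))) (sumTo-+ n _ _)

alternatingSum-*ˡ : ∀ n c (f : ℕ → ℚ) → alternatingSum n (λ k → c * f k) ≡ c * alternatingSum n f
alternatingSum-*ˡ n c f =
  trans (sumTo-cong n (λ k → ℚ*.x∙yz≈y∙xz (nat (n C k) * sign k) c (f k))) (sumTo-*ˡ n c _)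

alternatingSum-const : ∀ n → alternatingSum (suc n) (λ _ → 1ℚ) ≡ 0ℚ
alternatingSum-const n = begin
  alternatingSum (suc n) (λ _ → 1ℚ)
    ≡⟨ sumTo-cong (suc n) (λ k → trans (ℚP.*-identityʳ _) (pascal k)) ⟩
  sumTo (suc n) (λ k → b (suc k) - b k)
    ≡⟨ sumTo-telescope (suc n) b ⟩
  nat (n C suc n) * sign (suc n) - 0ℚ
    ≡⟨ cong (λ c → nat c * sign (suc n) - 0ℚ) (k>n⇒nCk≡0 (ℕP.n<1+n n)) ⟩
  0ℚ * sign (suc n) - 0ℚ
    ≡⟨ solve 1 (λ s → con 0ℚ :* s :- con 0ℚ := con 0ℚ) refl (sign (suc n)) ⟩
  0ℚ ∎
  where
  b : ℕ → ℚ
  b zero    = 0ℚ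
  b (suc k) = nat (n C k) * sign k
  pascal : ∀ k → nat (suc n C k) * sign k ≡ b (suc k) - b k
  pascal zero    = refl
  pascal (suc k) = begin
    nat (suc n C suc k) * - sign k
      ≡⟨ cong (_* - sign k) (cong nat (nCk+nC[k+1]≡[n+1]C[k+1] n k)) ⟨
    nat (n C k ℕ.+ n C suc k) * - sign k
      ≡⟨ cong (_* - sign k) (nat-+ (n C k) (n C suc k)) ⟩
    (nat (n C k) + nat (n C suc k)) * - sign k
      ≡⟨ solve 3 (λ y z s → (y :+ z) :* (:- s) := z :* (:- s) :- y :* s) refl (nat (n C k)) (nat (n C suc k)) (sign k) ⟩
    nat (n C suc k) * - sign k - nat (n C k) * sign k ∎

alternatingSum-[n+1-k] : ∀ n (g : ℕ → ℚ) →
  alternatingSum (suc n) (λ k → (nat (suc n) - nat k) * g k) ≡ nat (suc n) * alternatingSum n g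
alternatingSum-[n+1-k] n g = begin
  sumTo n F + F (suc n)                          ≡⟨ cong₂ _+_ (sumTo-cong n absorb) lastTerm ⟩
  sumTo n (λ k → N * (nat (n C k) * sign k * g k)) + 0ℚ
                                                 ≡⟨ ℚP.+-identityʳ _ ⟩
  sumTo n (λ k → N * (nat (n C k) * sign k * g k))
                                                 ≡⟨ sumTo-*ˡ n N _ ⟩
  N * alternatingSum n g                         ∎
  where
  N = nat (suc n)
  F : ℕ → ℚ
  F k = nat (suc n C k) * sign k * ((N - nat k) * g k)
  lastTerm : F (suc n) ≡ 0ℚ
  lastTerm rewrite ℚP.+-inverseʳ N =
    solve 3 (λ c s x → c :* s :* (con 0ℚ :* x) := con 0ℚ) refl (nat (suc n C suc n)) (sign (suc n)) (g (suc n))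
  absorb : ∀ k → F k ≡ N * (nat (n C k) * sign k * g k)
  absorb k = begin
    F k
      ≡⟨ solve 4 (λ c s d x → c :* s :* (d :* x) := c :* d :* (s :* x)) refl (nat (suc n C k)) (sign k) (N - nat k) (g k) ⟩
    nat (suc n C k) * (N - nat k) * (sign k * g k)
      ≡⟨ cong (_* (sign k * g k)) ([n+1]Ck*[n+1-k]≡[n+1]*nCk n k) ⟩
    N * nat (n C k) * (sign k * g k)
      ≡⟨ solve 4 (λ a c s x → a :* c :* (s :* x) := a :* (c :* s :* x)) refl N (nat (n C k)) (sign k) (g k) ⟩
    N * (nat (n C k) * sign k * g k) ∎

alternatingSum-recurrence : ∀ n c {g h : ℕ → ℚ} → (∀ k → nat (k ℕ.+ c) * g k ≡ h k) →
  nat (suc n ℕ.+ c) * alternatingSum (suc n) g ≡ nat (suc n) * alternatingSum n g + alternatingSum (suc n) h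
alternatingSum-recurrence n c {g} {h} [k+c]g≡h = begin
  nat (suc n ℕ.+ c) * alternatingSum (suc n) g
    ≡⟨ alternatingSum-*ˡ (suc n) (nat (suc n ℕ.+ c)) g ⟨
  alternatingSum (suc n) (λ k → nat (suc n ℕ.+ c) * g k)
    ≡⟨ alternatingSum-cong (suc n) split ⟩
  alternatingSum (suc n) (λ k → (N - nat k) * g k + h k)
    ≡⟨ alternatingSum-+ (suc n) _ h ⟩
  alternatingSum (suc n) (λ k → (N - nat k) * g k) + alternatingSum (suc n) h
    ≡⟨ cong (_+ alternatingSum (suc n) h) (alternatingSum-[n+1-k] n g) ⟩
  N * alternatingSum n g + alternatingSum (suc n) h ∎
  where
  N = nat (suc n)
  split : ∀ k → nat (suc n ℕ.+ c) * g k ≡ (N - nat k) * g k + h k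
  split k = begin
    nat (suc n ℕ.+ c) * g k
      ≡⟨ cong (_* g k) (nat-+ (suc n) c) ⟩
    (N + nat c) * g k
      ≡⟨ solve 4 (λ N C K x → (N :+ C) :* x := (N :- K) :* x :+ (K :+ C) :* x) refl N (nat c) (nat k) (g k) ⟩
    (N - nat k) * g k + (nat k + nat c) * g k
      ≡⟨ cong (λ y → (N - nat k) * g k + y * g k) (nat-+ k c) ⟨
    (N - nat k) * g k + nat (k ℕ.+ c) * g k
      ≡⟨ cong (λ y → (N - nat k) * g k + y) ([k+c]g≡h k) ⟩
    (N - nat k) * g k + h k ∎

alternatingSum-1/[k+1] : ∀ n → alternatingSum n (λ k → frac (+ 1) (k ℕ.+ 1)) ≡ frac (+ 1) (n ℕ.+ 1)
alternatingSum-1/[k+1] zero    = refl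
alternatingSum-1/[k+1] (suc n) = frac-unique 1 (ℕP.m+1+n≢0 (suc n)) (begin
  nat (suc n ℕ.+ 1) * alternatingSum (suc n) g
    ≡⟨ alternatingSum-recurrence n 1 (λ k → frac-inverse 1 (ℕP.m+1+n≢0 k)) ⟩
  nat (suc n) * alternatingSum n g + alternatingSum (suc n) (λ _ → 1ℚ)
    ≡⟨ cong₂ (λ x y → nat x * alternatingSum n g + y) (ℕP.+-comm 1 n) (alternatingSum-const n) ⟩
  nat (n ℕ.+ 1) * alternatingSum n g + 0ℚ
    ≡⟨ ℚP.+-identityʳ _ ⟩
  nat (n ℕ.+ 1) * alternatingSum n g
    ≡⟨ cong (nat (n ℕ.+ 1) *_) (alternatingSum-1/[k+1] n) ⟩
  nat (n ℕ.+ 1) * frac (+ 1) (n ℕ.+ 1)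
    ≡⟨ frac-inverse 1 (ℕP.m+1+n≢0 n) ⟩
  nat 1 ∎)
  where
  g : ℕ → ℚ
  g k = frac (+ 1) (k ℕ.+ 1)

alternatingSum-1/[k+1][k+2] : ∀ n →
  alternatingSum n (λ k → frac (+ 1) ((k ℕ.+ 1) ℕ.* (k ℕ.+ 2))) ≡ frac (+ 1) (n ℕ.+ 2)
alternatingSum-1/[k+1][k+2] zero    = refl
alternatingSum-1/[k+1][k+2] (suc n) = frac-unique 1 (ℕP.m+1+n≢0 (suc n)) (begin
  nat (suc n ℕ.+ 2) * alternatingSum (suc n) g
    ≡⟨ alternatingSum-recurrence n 2 (λ k → nat*frac[a*b]≡frac (ℕP.m+1+n≢0 k) (ℕP.m+1+n≢0 k)) ⟩
  nat (suc n) * alternatingSum n g + alternatingSum (suc n) (λ k → frac (+ 1) (k ℕ.+ 1))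
    ≡⟨ cong₂ (λ x y → nat (suc n) * x + y) (alternatingSum-1/[k+1][k+2] n) 1/[n+2] ⟩
  nat (suc n) * t + t
    ≡⟨ solve 2 (λ m t → m :* t :+ t := (m :+ con 1ℚ) :* t) refl (nat (suc n)) t ⟩
  (nat (suc n) + nat 1) * t
    ≡⟨ cong (_* t) (nat-+ (suc n) 1) ⟨
  nat (suc n ℕ.+ 1) * t
    ≡⟨ cong (λ d → nat d * t) (ℕP.+-suc n 1) ⟨
  nat (n ℕ.+ 2) * t
    ≡⟨ frac-inverse 1 (ℕP.m+1+n≢0 n) ⟩
  nat 1 ∎)
  where
  g : ℕ → ℚ
  g k = frac (+ 1) ((k ℕ.+ 1) ℕ.* (k ℕ.+ 2))
  t = frac (+ 1) (n ℕ.+ 2)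
  1/[n+2] : alternatingSum (suc n) (λ k → frac (+ 1) (k ℕ.+ 1)) ≡ t
  1/[n+2] = trans (alternatingSum-1/[k+1] (suc n)) (cong (frac (+ 1)) (sym (ℕP.+-suc n 1)))

risingFrom-suc-shift : ∀ n r → suc n ℕ.* risingFrom (suc n) r ≡ risingFrom n (suc r)
risingFrom-suc-shift n zero = begin
  suc n ℕ.* 1        ≡⟨ ℕP.*-identityʳ (suc n) ⟩
  suc n              ≡⟨ ℕP.+-comm n 1 ⟨
  n ℕ.+ 1            ≡⟨ ℕP.*-identityˡ (n ℕ.+ 1) ⟨
  1 ℕ.* (n ℕ.+ 1)    ∎
risingFrom-suc-shift n (suc r) = begin
  suc n ℕ.* (risingFrom (suc n) r ℕ.* (suc n ℕ.+ suc r))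
    ≡⟨ ℕP.*-assoc (suc n) (risingFrom (suc n) r) (suc n ℕ.+ suc r) ⟨
  suc n ℕ.* risingFrom (suc n) r ℕ.* (suc n ℕ.+ suc r)
    ≡⟨ cong₂ ℕ._*_ (risingFrom-suc-shift n r) (sym (ℕP.+-suc n (suc r))) ⟩
  risingFrom n (suc r) ℕ.* (n ℕ.+ suc (suc r)) ∎

risingFrom*alternatingSum : ∀ r n →
  nat (risingFrom n (suc r)) * alternatingSum n (λ k → frac (+ 1) ((k ℕ.+ 1) ℕ.* (k ℕ.+ 2) ℕ.* (k ℕ.+ suc r)))
    ≡ sumTo n (λ k → frac (+ risingFrom k r) (k ℕ.+ 2))
risingFrom*alternatingSum r zero = begin
  nat (P ℕ.* suc r) * alternatingSum 0 g
    ≡⟨ cong (nat (P ℕ.* suc r) *_) (alternatingSum-zero g) ⟩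
  nat (P ℕ.* suc r) * g 0
    ≡⟨ cong (_* g 0) (nat-* P (suc r)) ⟩
  nat P * nat (suc r) * g 0
    ≡⟨ ℚP.*-assoc (nat P) (nat (suc r)) (g 0) ⟩
  nat P * (nat (suc r) * frac (+ 1) (2 ℕ.* suc r))
    ≡⟨ cong (nat P *_) (nat*frac[a*b]≡frac {2} {suc r} (λ ()) (λ ())) ⟩
  nat P * frac (+ 1) 2
    ≡⟨ nat*frac1≡frac P {2} (λ ()) ⟩
  frac (+ P) 2 ∎
  where
  P = risingFrom 0 r
  g : ℕ → ℚ
  g k = frac (+ 1) ((k ℕ.+ 1) ℕ.* (k ℕ.+ 2) ℕ.* (k ℕ.+ suc r))
risingFrom*alternatingSum r (suc n) = begin
  nat (P ℕ.* (m ℕ.+ suc r)) * alternatingSum m g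
    ≡⟨ cong (_* alternatingSum m g) (nat-* P (m ℕ.+ suc r)) ⟩
  nat P * nat (m ℕ.+ suc r) * alternatingSum m g
    ≡⟨ ℚP.*-assoc (nat P) (nat (m ℕ.+ suc r)) _ ⟩
  nat P * (nat (m ℕ.+ suc r) * alternatingSum m g)
    ≡⟨ cong (nat P *_) (alternatingSum-recurrence n (suc r) [k+r]g≡1/[k+1][k+2]) ⟩
  nat P * (nat m * alternatingSum n g + alternatingSum m (λ k → frac (+ 1) ((k ℕ.+ 1) ℕ.* (k ℕ.+ 2))))
    ≡⟨ cong (λ x → nat P * (nat m * alternatingSum n g + x)) (alternatingSum-1/[k+1][k+2] m) ⟩
  nat P * (nat m * alternatingSum n g + t)
    ≡⟨ solve 4 (λ p m s t → p :* (m :* s :+ t) := m :* p :* s :+ p :* t) refl (nat P) (nat m) (alternatingSum n g) t ⟩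
  nat m * nat P * alternatingSum n g + nat P * t
    ≡⟨ cong₂ (λ x y → x * alternatingSum n g + y) shift (nat*frac1≡frac P (ℕP.m+1+n≢0 m)) ⟩
  nat (risingFrom n (suc r)) * alternatingSum n g + frac (+ P) (m ℕ.+ 2)
    ≡⟨ cong (_+ frac (+ P) (m ℕ.+ 2)) (risingFrom*alternatingSum r n) ⟩
  sumTo n (λ k → frac (+ risingFrom k r) (k ℕ.+ 2)) + frac (+ P) (m ℕ.+ 2)
                                                        ∎
  where
  m = suc n
  P = risingFrom m r
  t = frac (+ 1) (m ℕ.+ 2)
  g : ℕ → ℚ
  g k = frac (+ 1) ((k ℕ.+ 1) ℕ.* (k ℕ.+ 2) ℕ.* (k ℕ.+ suc r))
  [k+r]g≡1/[k+1][k+2] : ∀ k → nat (k ℕ.+ suc r) * g k ≡ frac (+ 1) ((k ℕ.+ 1) ℕ.* (k ℕ.+ 2))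
  [k+r]g≡1/[k+1][k+2] k = nat*frac[a*b]≡frac (*-≢0 (ℕP.m+1+n≢0 k) (ℕP.m+1+n≢0 k)) (ℕP.m+1+n≢0 k)
  shift : nat m * nat P ≡ nat (risingFrom n (suc r))
  shift = trans (sym (nat-* m P)) (cong nat (risingFrom-suc-shift n r))

sumTo-1/[k+2] : ∀ n → sumTo n (λ k → frac (+ 1) (k ℕ.+ 2)) ≡ H (n ℕ.+ 2) - nat 1
sumTo-1/[k+2] zero    = refl
sumTo-1/[k+2] (suc n) = begin
  sumTo n (λ k → frac (+ 1) (k ℕ.+ 2)) + t
    ≡⟨ cong (_+ t) (sumTo-1/[k+2] n) ⟩
  H (n ℕ.+ 2) - nat 1 + t
    ≡⟨ solve 2 (λ h t → h :- con 1ℚ :+ t := h :+ t :- con 1ℚ) refl (H (n ℕ.+ 2)) t ⟩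
  H (n ℕ.+ 2) + t - nat 1 ∎
  where t = frac (+ 1) (suc n ℕ.+ 2)

sumTo-[k+1]/[k+2] : ∀ n → sumTo n (λ k → frac (+ (k ℕ.+ 1)) (k ℕ.+ 2)) ≡ nat (n ℕ.+ 2) - H (n ℕ.+ 2)
sumTo-[k+1]/[k+2] zero    = refl
sumTo-[k+1]/[k+2] (suc n) = begin
  sumTo n (λ k → frac (+ (k ℕ.+ 1)) (k ℕ.+ 2)) + frac (+ (suc n ℕ.+ 1)) (suc n ℕ.+ 2)
    ≡⟨ cong₂ _+_ (sumTo-[k+1]/[k+2] n) (1-1/[k+2] (suc n)) ⟩
  nat (n ℕ.+ 2) - H (n ℕ.+ 2) + (1ℚ - t)
    ≡⟨ solve 3 (λ d h t → d :- h :+ (con 1ℚ :- t) := con 1ℚ :+ d :- (h :+ t)) refl (nat (n ℕ.+ 2)) (H (n ℕ.+ 2)) t ⟩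
  1ℚ + nat (n ℕ.+ 2) - (H (n ℕ.+ 2) + t)
    ≡⟨ cong (_- (H (n ℕ.+ 2) + t)) (nat-+ 1 (n ℕ.+ 2)) ⟨
  nat (suc n ℕ.+ 2) - H (suc n ℕ.+ 2) ∎
  where
  t = frac (+ 1) (suc n ℕ.+ 2)
  1-1/[k+2] : ∀ k → frac (+ (k ℕ.+ 1)) (k ℕ.+ 2) ≡ 1ℚ - frac (+ 1) (k ℕ.+ 2)
  1-1/[k+2] k = sym (frac-unique (k ℕ.+ 1) (ℕP.m+1+n≢0 k) (begin
    nat (k ℕ.+ 2) * (1ℚ - frac (+ 1) (k ℕ.+ 2))
      ≡⟨ solve 2 (λ d f → d :* (con 1ℚ :- f) := d :- d :* f) refl (nat (k ℕ.+ 2)) (frac (+ 1) (k ℕ.+ 2)) ⟩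
    nat (k ℕ.+ 2) - nat (k ℕ.+ 2) * frac (+ 1) (k ℕ.+ 2)
      ≡⟨ cong (λ x → nat (k ℕ.+ 2) - x) (frac-inverse 1 (ℕP.m+1+n≢0 k)) ⟩
    nat (k ℕ.+ 2) - nat 1
      ≡⟨ cong (λ d → nat d - nat 1) (ℕP.+-assoc k 1 1) ⟨
    nat (k ℕ.+ 1 ℕ.+ 1) - nat 1
      ≡⟨ cong (_- nat 1) (nat-+ (k ℕ.+ 1) 1) ⟩
    nat (k ℕ.+ 1) + nat 1 - nat 1
      ≡⟨ solve 1 (λ x → x :+ con 1ℚ :- con 1ℚ := x) refl (nat (k ℕ.+ 1)) ⟩
    nat (k ℕ.+ 1) ∎))

2*sumTo-[k+1] : ∀ n → nat 2 * sumTo n (λ k → nat (k ℕ.+ 1)) ≡ nat (n ℕ.+ 1) * nat (n ℕ.+ 2)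
2*sumTo-[k+1] zero    = refl
2*sumTo-[k+1] (suc n) = begin
  nat 2 * (sumTo n (λ k → nat (k ℕ.+ 1)) + nat (suc n ℕ.+ 1))
    ≡⟨ ℚP.*-distribˡ-+ (nat 2) (sumTo n (λ k → nat (k ℕ.+ 1))) (nat (suc n ℕ.+ 1)) ⟩
  nat 2 * sumTo n (λ k → nat (k ℕ.+ 1)) + nat 2 * nat (suc n ℕ.+ 1)
    ≡⟨ cong₂ (λ x y → x + nat 2 * y) (2*sumTo-[k+1] n) (nat-+ 1 (n ℕ.+ 1)) ⟩
  nat (n ℕ.+ 1) * nat (n ℕ.+ 2) + nat 2 * (1ℚ + nat (n ℕ.+ 1))
    ≡⟨ cong₂ (λ x y → x * y + nat 2 * (1ℚ + x)) (nat-+ n 1) (nat-+ n 2) ⟩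
  (nat n + 1ℚ) * (nat n + nat 2) + nat 2 * (1ℚ + (nat n + 1ℚ))
    ≡⟨ solve 1 (λ x → (x :+ con 1ℚ) :* (x :+ con (nat 2)) :+ con (nat 2) :* (con 1ℚ :+ (x :+ con 1ℚ))
                   := (con 1ℚ :+ (x :+ con 1ℚ)) :* (con 1ℚ :+ (x :+ con (nat 2)))) refl (nat n) ⟩
  (1ℚ + (nat n + 1ℚ)) * (1ℚ + (nat n + nat 2))
    ≡⟨ cong₂ (λ x y → (1ℚ + x) * (1ℚ + y)) (nat-+ n 1) (nat-+ n 2) ⟨
  (1ℚ + nat (n ℕ.+ 1)) * (1ℚ + nat (n ℕ.+ 2))
    ≡⟨ cong₂ _*_ (nat-+ 1 (n ℕ.+ 1)) (nat-+ 1 (n ℕ.+ 2)) ⟨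
  nat (suc n ℕ.+ 1) * nat (suc n ℕ.+ 2)
    ∎

alternatingSum-1/[k+1][k+2][k+r] : (n r : ℕ) → 1 ℕ.≤ r →
  sumTo n (λ k → nat (n C k) * sign k * frac (+ 1) ((k ℕ.+ 1) ℕ.* (k ℕ.+ 2) ℕ.* (k ℕ.+ r)))
    ≡ frac (+ 1) (risingFrom n r) * sumTo n (λ k → frac (+ risingFrom k (r ℕ.∸ 1)) (k ℕ.+ 2))
alternatingSum-1/[k+1][k+2][k+r] n (suc r) _ =
  nat*≡⇒≡frac1* (risingFrom≢0 n (suc r)) (risingFrom*alternatingSum r n)

alternatingSum-1/[k+1]²[k+2] : (n : ℕ) →
  sumTo n (λ k → nat (n C k) * sign k * frac (+ 1) ((k ℕ.+ 1) ℕ.* (k ℕ.+ 1) ℕ.* (k ℕ.+ 2)))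
    ≡ (H (n ℕ.+ 2) - nat 1) * frac (+ 1) (n ℕ.+ 1)
alternatingSum-1/[k+1]²[k+2] n = begin
  alternatingSum n (λ k → frac (+ 1) ((k ℕ.+ 1) ℕ.* (k ℕ.+ 1) ℕ.* (k ℕ.+ 2)))
    ≡⟨ alternatingSum-cong n (λ k → cong (frac (+ 1)) (ℕ*.xy∙z≈xz∙y (k ℕ.+ 1) (k ℕ.+ 1) (k ℕ.+ 2))) ⟩
  alternatingSum n (λ k → frac (+ 1) ((k ℕ.+ 1) ℕ.* (k ℕ.+ 2) ℕ.* (k ℕ.+ 1)))
    ≡⟨ alternatingSum-1/[k+1][k+2][k+r] n 1 (ℕ.s≤s ℕ.z≤n) ⟩
  frac (+ 1) (1 ℕ.* (n ℕ.+ 1)) * sumTo n (λ k → frac (+ 1) (k ℕ.+ 2))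
    ≡⟨ cong₂ _*_ (cong (frac (+ 1)) (ℕP.*-identityˡ (n ℕ.+ 1))) (sumTo-1/[k+2] n) ⟩
  frac (+ 1) (n ℕ.+ 1) * (H (n ℕ.+ 2) - nat 1)
    ≡⟨ ℚP.*-comm (frac (+ 1) (n ℕ.+ 1)) (H (n ℕ.+ 2) - nat 1) ⟩
  (H (n ℕ.+ 2) - nat 1) * frac (+ 1) (n ℕ.+ 1)
    ∎

alternatingSum-1/[k+1][k+2]² : (n : ℕ) →
  sumTo n (λ k → nat (n C k) * sign k * frac (+ 1) ((k ℕ.+ 1) ℕ.* (k ℕ.+ 2) ℕ.* (k ℕ.+ 2)))
    ≡ (nat (n ℕ.+ 2) - H (n ℕ.+ 2)) * frac (+ 1) ((n ℕ.+ 1) ℕ.* (n ℕ.+ 2))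
alternatingSum-1/[k+1][k+2]² n = begin
  alternatingSum n (λ k → frac (+ 1) ((k ℕ.+ 1) ℕ.* (k ℕ.+ 2) ℕ.* (k ℕ.+ 2)))
    ≡⟨ alternatingSum-1/[k+1][k+2][k+r] n 2 (ℕ.s≤s ℕ.z≤n) ⟩
  frac (+ 1) (1 ℕ.* (n ℕ.+ 1) ℕ.* (n ℕ.+ 2)) * sumTo n (λ k → frac (+ (1 ℕ.* (k ℕ.+ 1))) (k ℕ.+ 2))
    ≡⟨ cong₂ _*_ (cong (λ d → frac (+ 1) (d ℕ.* (n ℕ.+ 2))) (ℕP.*-identityˡ (n ℕ.+ 1)))
                 (sumTo-cong n (λ k → cong (λ p → frac (+ p) (k ℕ.+ 2)) (ℕP.*-identityˡ (k ℕ.+ 1)))) ⟩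
  frac (+ 1) ((n ℕ.+ 1) ℕ.* (n ℕ.+ 2)) * sumTo n (λ k → frac (+ (k ℕ.+ 1)) (k ℕ.+ 2))
    ≡⟨ cong (frac (+ 1) ((n ℕ.+ 1) ℕ.* (n ℕ.+ 2)) *_) (sumTo-[k+1]/[k+2] n) ⟩
  frac (+ 1) ((n ℕ.+ 1) ℕ.* (n ℕ.+ 2)) * (nat (n ℕ.+ 2) - H (n ℕ.+ 2))
    ≡⟨ ℚP.*-comm (frac (+ 1) ((n ℕ.+ 1) ℕ.* (n ℕ.+ 2))) _ ⟩
  (nat (n ℕ.+ 2) - H (n ℕ.+ 2)) * frac (+ 1) ((n ℕ.+ 1) ℕ.* (n ℕ.+ 2))
    ∎

alternatingSum-1/[k+1][k+2][k+3] : (n : ℕ) →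
  sumTo n (λ k → nat (n C k) * sign k * frac (+ 1) ((k ℕ.+ 1) ℕ.* (k ℕ.+ 2) ℕ.* (k ℕ.+ 3)))
    ≡ frac (+ 1) (2 ℕ.* (n ℕ.+ 3))
alternatingSum-1/[k+1][k+2][k+3] n = begin
  alternatingSum n (λ k → frac (+ 1) ((k ℕ.+ 1) ℕ.* (k ℕ.+ 2) ℕ.* (k ℕ.+ 3)))
    ≡⟨ alternatingSum-1/[k+1][k+2][k+r] n 3 (ℕ.s≤s ℕ.z≤n) ⟩
  f * sumTo n (λ k → frac (+ (1 ℕ.* (k ℕ.+ 1) ℕ.* (k ℕ.+ 2))) (k ℕ.+ 2))
    ≡⟨ cong (f *_) (sumTo-cong n [k+1][k+2]/[k+2]≡k+1) ⟩
  f * sumTo n (λ k → nat (k ℕ.+ 1))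
    ≡⟨ frac-unique 1 (*-≢0 {2} (λ ()) (ℕP.m+1+n≢0 n)) 2[n+3]*f*S≡1 ⟩
  frac (+ 1) (2 ℕ.* (n ℕ.+ 3))
    ∎
  where
  R = risingFrom n 3
  f = frac (+ 1) R
  S = sumTo n (λ k → nat (k ℕ.+ 1))
  [k+1][k+2]/[k+2]≡k+1 : ∀ k → frac (+ (1 ℕ.* (k ℕ.+ 1) ℕ.* (k ℕ.+ 2))) (k ℕ.+ 2) ≡ nat (k ℕ.+ 1)
  [k+1][k+2]/[k+2]≡k+1 k =
    trans (frac[a*b/b]≡a (1 ℕ.* (k ℕ.+ 1)) (ℕP.m+1+n≢0 k)) (cong nat (ℕP.*-identityˡ (k ℕ.+ 1)))
  nat-R : nat R ≡ nat (n ℕ.+ 1) * nat (n ℕ.+ 2) * nat (n ℕ.+ 3)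
  nat-R = begin
    nat (1 ℕ.* (n ℕ.+ 1) ℕ.* (n ℕ.+ 2) ℕ.* (n ℕ.+ 3))
      ≡⟨ cong (λ d → nat (d ℕ.* (n ℕ.+ 2) ℕ.* (n ℕ.+ 3))) (ℕP.*-identityˡ (n ℕ.+ 1)) ⟩
    nat ((n ℕ.+ 1) ℕ.* (n ℕ.+ 2) ℕ.* (n ℕ.+ 3))
      ≡⟨ nat-* ((n ℕ.+ 1) ℕ.* (n ℕ.+ 2)) (n ℕ.+ 3) ⟩
    nat ((n ℕ.+ 1) ℕ.* (n ℕ.+ 2)) * nat (n ℕ.+ 3)
      ≡⟨ cong (_* nat (n ℕ.+ 3)) (nat-* (n ℕ.+ 1) (n ℕ.+ 2)) ⟩
    nat (n ℕ.+ 1) * nat (n ℕ.+ 2) * nat (n ℕ.+ 3) ∎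
  2[n+3]*f*S≡1 : nat (2 ℕ.* (n ℕ.+ 3)) * (f * S) ≡ nat 1
  2[n+3]*f*S≡1 = begin
    nat (2 ℕ.* (n ℕ.+ 3)) * (f * S)
      ≡⟨ cong (_* (f * S)) (nat-* 2 (n ℕ.+ 3)) ⟩
    nat 2 * nat (n ℕ.+ 3) * (f * S)
      ≡⟨ solve 4 (λ t c f s → t :* c :* (f :* s) := (t :* s :* c) :* f) refl (nat 2) (nat (n ℕ.+ 3)) f S ⟩
    nat 2 * S * nat (n ℕ.+ 3) * f
      ≡⟨ cong (λ x → x * nat (n ℕ.+ 3) * f) (2*sumTo-[k+1] n) ⟩
    nat (n ℕ.+ 1) * nat (n ℕ.+ 2) * nat (n ℕ.+ 3) * f
      ≡⟨ cong (_* f) nat-R ⟨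
    nat R * f
      ≡⟨ frac-inverse 1 (risingFrom≢0 n 3) ⟩
    nat 1 ∎

corollary21 : ((n r : ℕ) → 1 ℕ.≤ r →
                  sumTo n (λ k → nat (n C k) * sign k * frac (+ 1) ((k ℕ.+ 1) ℕ.* (k ℕ.+ 2) ℕ.* (k ℕ.+ r)))
                    ≡ frac (+ 1) (risingFrom n r) * sumTo n (λ k → frac (+ risingFrom k (r ℕ.∸ 1)) (k ℕ.+ 2)))
                × ((n : ℕ) → sumTo n (λ k → nat (n C k) * sign k * frac (+ 1) ((k ℕ.+ 1) ℕ.* (k ℕ.+ 1) ℕ.* (k ℕ.+ 2)))
                    ≡ (H (n ℕ.+ 2) - nat 1) * frac (+ 1) (n ℕ.+ 1))
                × ((n : ℕ) → sumTo n (λ k → nat (n C k) * sign k * frac (+ 1) ((k ℕ.+ 1) ℕ.* (k ℕ.+ 2) ℕ.* (k ℕ.+ 2)))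
                    ≡ (nat (n ℕ.+ 2) - H (n ℕ.+ 2)) * frac (+ 1) ((n ℕ.+ 1) ℕ.* (n ℕ.+ 2)))
                × ((n : ℕ) → sumTo n (λ k → nat (n C k) * sign k * frac (+ 1) ((k ℕ.+ 1) ℕ.* (k ℕ.+ 2) ℕ.* (k ℕ.+ 3)))
                    ≡ frac (+ 1) (2 ℕ.* (n ℕ.+ 3)))
corollary21 =
    alternatingSum-1/[k+1][k+2][k+r]
  , alternatingSum-1/[k+1]²[k+2]
  , alternatingSum-1/[k+1][k+2]²
  , alternatingSum-1/[k+1][k+2][k+3]
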